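{- Let $\Delta$ be a finite saturated sample set. There exists an effective procedure that produces, for any $\Delta$-diagram $\delta$ and any term variable $x$, an algorithmic description of a time warp $f$ that strongly extends $D^{\delta}_x$.
   Context: Let $\overline{\omega}=\omega\cup\{\omega\}$ with its natural order. A time warp is a function $f:\overline{\omega}\to\overline{\omega}$ preserving all suprema (equivalently monotone with $f(0)=0$ and $f(\omega)=\bigvee_{n\in\omega}f(n)$); $\mathrm{last}(f):=\bigwedge\{p\in\overline\omega\mid f(p)=f(\omega)\}$. Basic terms: $t,u::=x\mid tu\mid t^{o}\mid t^{\ell}\mid t^{r}\mid\mathrm{id}\mid\bot$ ($x$ a term variable). Samples: $\alpha::=\kappa\mid t[\alpha]\mid\mathsf{s}(\alpha)\mid\mathsf{p}(\alpha)\mid\mathsf{last}(t)$ with $\kappa$ a time variable and $t$ a basic term. The relation $\leadsto$: $t[\alpha]\leadsto\alpha$; $\mathsf{s}(\alpha)\leadsto\alpha$; $\mathsf{p}(\alpha)\leadsto\alpha$; $(tu)[\alpha]\leadsto t[u[\alpha]]$; $t^{o}[\alpha]\leadsto t[\alpha]$; $t^{r}[\alpha]\leadsto t[t^{r}[\alpha]],\ t[\mathsf{s}(t^{r}[\alpha])]$; $t^{\ell}[\alpha]\leadsto t[t^{\ell}[\alpha]],\ t[\mathsf{p}(t^{\ell}[\alpha])]$; $t[\alpha]\leadsto t[\mathsf{last}(t)]$. A sample set $\Delta$ is saturated if $\alpha\in\Delta$ and $\alpha\leadsto\beta$ imply $\beta\in\Delta$. For $p\in\overline{\omega}$: $p\ominus1=p-1$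 if $p\in\omega\setminus\{0\}$, else $p$; $p\oplus1=p+1$ if $p\in\omega$, else $p$. For a saturated $\Delta$, a $\Delta$-diagram is a map $\delta:\Delta\to\overline{\omega}$ such that, for all samples mentioned lying in $\Delta$: (1) $\delta(\alpha)\le\delta(\beta)\Rightarrow\delta(t[\alpha])\le\delta(t[\beta])$; (2) $\delta(\alpha)=0\Rightarrow\delta(t[\alpha])=0$; (3) $\delta(\mathsf{p}(\alpha))=\delta(\alpha)\ominus1$; (4) $\delta(\mathsf{s}(\alpha))=\delta(\alpha)\oplus1$; (5) for $t[\alpha]\in\Delta$: $\delta(\mathsf{last}(t))\le\delta(\alpha)\iff\delta(t[\alpha])=\delta(t[\mathsf{last}(t)])$; (6) $\delta(\mathsf{last}(t))=\omega\Rightarrow\delta(t[\mathsf{last}(t)])=\omega$ for $t[\mathsf{last}(t)]\in\Delta$; (7) $\delta(\mathrm{id}[\alpha])=\delta(\alpha)$; (8) if $\bot[\alpha]\in\Delta$ then $\delta(\mathsf{last}(\bot))=0$; (9) $\delta((tu)[\alpha])=\delta(t[u[\alpha]])$; (10) for $(tu)[\mathsf{last}(tu)]\in\Delta$: $\delta(\mathsf{last}(tu))=\omega\Rightarrow\delta(\mathsf{last}(t))=\delta(\mathsf{last}(u))=\omega$; (11) $\delta(t^{o}[\alpha])\in\{0,\omega\}$; (12) $\delta(\alpha)<\omega\Rightarrow(\delta(t^{o}[\alpha])=\omega\iff\delta(t[\alpha])=\omega)$; (13) $\delta(\mathsf{last}(t^{o}))<\omega$; (14) for $t[\alpha],t^{o}[\mathsf{last}(t^{o})]\in\Delta$: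 $\delta(t^{o}[\mathsf{last}(t^{o})])<\omega$ and $\delta(\alpha)<\omega$ imply $\delta(t[\alpha])<\omega$; (15) $\delta(t[t^{r}[\alpha]])\le\delta(\alpha)$; (16) for $t^{r}[\alpha]\in\Delta$: $0<\delta(\alpha)<\omega$ and $\delta(t^{r}[\alpha])<\omega$ imply $\delta(\alpha)<\delta(t[\mathsf{s}(t^{r}[\alpha])])$; (17) for $t^{r}[\mathsf{last}(t^{r})]\in\Delta$: $\delta(\mathsf{last}(t^{r}))=\omega\Rightarrow\delta(\mathsf{last}(t))=\omega$; (18) for $t^{r}[\mathsf{last}(t^{r})]\in\Delta$: $\delta(t^{r}[\mathsf{last}(t^{r})])<\omega\Rightarrow\delta(t[\mathsf{s}(t^{r}[\mathsf{last}(t^{r})])])=\omega$; (19) for $t[t^{\ell}[\alpha]]\in\Delta$: $\delta(t^{\ell}[\alpha])<\omega\Rightarrow\delta(\alpha)\le\delta(t[t^{\ell}[\alpha]])$; (20) for $t^{\ell}[\alpha]\in\Delta$: $0<\delta(\alpha)<\omega$ and $\delta(t^{\ell}[\alpha])<\omega$ imply $\delta(t[\mathsf{p}(t^{\ell}[\alpha])])<\delta(\alpha)$; (21) for $t[t^{\ell}[\alpha]]\in\Delta$: $\delta(\alpha)<\omega$ and $\delta(t^{\ell}[\alpha])=\omega$ imply $\delta(t[t^{\ell}[\alpha]])<\delta(\alpha)$; (22) for $t^{\ell}[\mathsf{last}(t^{\ell})]\in\Delta$: $\delta(\mathsf{last}(t^{\ell}))=\omega\Rightarrow\delta(\mathsf{last}(t))=\omega$;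 (23) for $t^{\ell}[\mathsf{last}(t^{\ell})]\in\Delta$: $\delta(t^{\ell}[\mathsf{last}(t^{\ell})])<\omega\Rightarrow\delta(t[t^{\ell}[\mathsf{last}(t^{\ell})]])=\omega$. For a $\Delta$-diagram $\delta$ and basic term $t$, let $D^{\delta}_t:=\{(\delta(\alpha),\delta(t[\alpha]))\mid t[\alpha]\in\Delta\}$. A time warp $f$ extends $D^\delta_t$ if $f(i)=j$ for all $(i,j)\in D^\delta_t$, and strongly extends it if moreover either $D^\delta_t=\emptyset$, or ($D^\delta_t\neq\emptyset$ and $\delta(\mathsf{last}(t))=\omega$ implies $\mathrm{last}(f)=\omega$). -}

module Defs where

open import Data.Nat using (ℕ; zero; suc; _<_; _≤_)
open import Data.Maybe using (Maybe; just; nothing)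
open import Data.Product using (Σ; Σ-syntax; _×_; _,_)
open import Data.Sum using (_⊎_)
open import Data.List using (List)
open import Data.List.Membership.Propositional using (_∈_)
open import Relation.Binary.PropositionalEquality using (_≡_)
open import Relation.Nullary using (¬_)
open import Function.Bundles using (_⇔_)

-- ω̄ = ω ∪ {ω}, represented as Maybe ℕ with nothing = ω

ω̄ : Set
ω̄ = Maybe ℕ

ω : ω̄
ω = nothing

infix 4 _≤̄_ _<̄_

data _≤̄_ : ω̄ → ω̄ → Set where
  fin≤fin : ∀ {m n} → m ≤ n → just m ≤̄ just n
  _≤ω     : ∀ p → p ≤̄ ω

data _<̄_ : ω̄ → ω̄ → Set where
  fin<fin : ∀ {m n} → m < n → just m <̄ just n
  fin<ω   : ∀ {m} → just m <̄ ω

_⊖1 : ω̄ → ω̄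
just zero    ⊖1 = just zero
just (suc n) ⊖1 = just n
nothing      ⊖1 = nothing

_⊕1 : ω̄ → ω̄
just n  ⊕1 = just (suc n)
nothing ⊕1 = nothing

IsSup : {I : Set} → (I → ω̄) → ω̄ → Set
IsSup {I} g u = (∀ i → g i ≤̄ u) × (∀ v → (∀ i → g i ≤̄ v) → u ≤̄ v)

IsInf : (ω̄ → Set) → ω̄ → Set
IsInf P l = (∀ p → P p → l ≤̄ p) × (∀ v → (∀ p → P p → v ≤̄ p) → v ≤̄ l)

record IsTimeWarp (f : ω̄ → ω̄) : Set where
  field
    monotone : ∀ p q → p ≤̄ q → f p ≤̄ f q
    zero↦zero : f (just zero) ≡ just zero
    ω↦sup : IsSup (λ (n : ℕ) → f (just n)) (f ω)

IsLast : (ω̄ → ω̄) → ω̄ → Set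
IsLast f l = IsInf (λ p → f p ≡ f ω) l

TermVar : Set
TermVar = ℕ

TimeVar : Set
TimeVar = ℕ

data Term : Set where
  var  : TermVar → Term
  _·_  : Term → Term → Term
  _ᵒ   : Term → Term
  _ˡ   : Term → Term
  _ʳ   : Term → Term
  idₜ  : Term
  ⊥ₜ   : Term

data Sample : Set where
  tv   : TimeVar → Sample
  _[_] : Term → Sample → Sample
  𝗌    : Sample → Sample
  𝗉    : Sample → Sample
  last : Term → Sample

infix 4 _⇝_

data _⇝_ : Sample → Sample → Set where
  arg    : ∀ t α → t [ α ] ⇝ α
  s-arg  : ∀ α → 𝗌 α ⇝ α
  p-arg  : ∀ α → 𝗉 α ⇝ α
  comp   : ∀ t u α → (t · u) [ α ] ⇝ t [ u [ α ] ]
  o-step : ∀ t α → (t ᵒ) [ α ] ⇝ t [ α ]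
  r-step₁ : ∀ t α → (t ʳ) [ α ] ⇝ t [ (t ʳ) [ α ] ]
  r-step₂ : ∀ t α → (t ʳ) [ α ] ⇝ t [ 𝗌 ((t ʳ) [ α ]) ]
  l-step₁ : ∀ t α → (t ˡ) [ α ] ⇝ t [ (t ˡ) [ α ] ]
  l-step₂ : ∀ t α → (t ˡ) [ α ] ⇝ t [ 𝗉 ((t ˡ) [ α ]) ]
  to-last : ∀ t α → t [ α ] ⇝ t [ last t ]

SampleSet : Set
SampleSet = List Sample

Saturated : SampleSet → Set
Saturated Δ = ∀ {α β} → α ∈ Δ → α ⇝ β → β ∈ Δ

-- Δ-diagrams.  δ is given as a map on all samples; only its values on
-- Δ are ever inspected (every map Δ → ω̄ extends to such a map).

record IsDiagram (Δ : SampleSet) (δ : Sample → ω̄) : Set where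
  field
    c1 : ∀ t α β → α ∈ Δ → β ∈ Δ → t [ α ] ∈ Δ → t [ β ] ∈ Δ →
         δ α ≤̄ δ β → δ (t [ α ]) ≤̄ δ (t [ β ])
    c2 : ∀ t α → α ∈ Δ → t [ α ] ∈ Δ →
         δ α ≡ just 0 → δ (t [ α ]) ≡ just 0
    c3 : ∀ α → α ∈ Δ → 𝗉 α ∈ Δ → δ (𝗉 α) ≡ (δ α) ⊖1
    c4 : ∀ α → α ∈ Δ → 𝗌 α ∈ Δ → δ (𝗌 α) ≡ (δ α) ⊕1
    c5 : ∀ t α → α ∈ Δ → t [ α ] ∈ Δ → last t ∈ Δ → t [ last t ] ∈ Δ →
         (δ (last t) ≤̄ δ α) ⇔ (δ (t [ α ]) ≡ δ (t [ last t ]))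
    c6 : ∀ t → last t ∈ Δ → t [ last t ] ∈ Δ →
         δ (last t) ≡ ω → δ (t [ last t ]) ≡ ω
    c7 : ∀ α → α ∈ Δ → idₜ [ α ] ∈ Δ → δ (idₜ [ α ]) ≡ δ α
    c8 : ∀ α → ⊥ₜ [ α ] ∈ Δ → last ⊥ₜ ∈ Δ → δ (last ⊥ₜ) ≡ just 0
    c9 : ∀ t u α → (t · u) [ α ] ∈ Δ → t [ u [ α ] ] ∈ Δ →
         δ ((t · u) [ α ]) ≡ δ (t [ u [ α ] ])
    c10 : ∀ t u → (t · u) [ last (t · u) ] ∈ Δ → last (t · u) ∈ Δ →
          last t ∈ Δ → last u ∈ Δ →
          δ (last (t · u)) ≡ ω → (δ (last t) ≡ ω) × (δ (last u) ≡ ω)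
    c11 : ∀ t α → (t ᵒ) [ α ] ∈ Δ →
          (δ ((t ᵒ) [ α ]) ≡ just 0) ⊎ (δ ((t ᵒ) [ α ]) ≡ ω)
    c12 : ∀ t α → α ∈ Δ → (t ᵒ) [ α ] ∈ Δ → t [ α ] ∈ Δ →
          δ α <̄ ω → (δ ((t ᵒ) [ α ]) ≡ ω) ⇔ (δ (t [ α ]) ≡ ω)
    c13 : ∀ t → last (t ᵒ) ∈ Δ → δ (last (t ᵒ)) <̄ ω
    c14 : ∀ t α → α ∈ Δ → t [ α ] ∈ Δ → (t ᵒ) [ last (t ᵒ) ] ∈ Δ →
          δ ((t ᵒ) [ last (t ᵒ) ]) <̄ ω → δ α <̄ ω → δ (t [ α ]) <̄ ω
    c15 : ∀ t α → α ∈ Δ → t [ (t ʳ) [ α ] ] ∈ Δ →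
          δ (t [ (t ʳ) [ α ] ]) ≤̄ δ α
    c16 : ∀ t α → α ∈ Δ → (t ʳ) [ α ] ∈ Δ → t [ 𝗌 ((t ʳ) [ α ]) ] ∈ Δ →
          just 0 <̄ δ α → δ α <̄ ω → δ ((t ʳ) [ α ]) <̄ ω →
          δ α <̄ δ (t [ 𝗌 ((t ʳ) [ α ]) ])
    c17 : ∀ t → (t ʳ) [ last (t ʳ) ] ∈ Δ → last (t ʳ) ∈ Δ → last t ∈ Δ →
          δ (last (t ʳ)) ≡ ω → δ (last t) ≡ ω
    c18 : ∀ t → (t ʳ) [ last (t ʳ) ] ∈ Δ →
          t [ 𝗌 ((t ʳ) [ last (t ʳ) ]) ] ∈ Δ →
          δ ((t ʳ) [ last (t ʳ) ]) <̄ ω →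
          δ (t [ 𝗌 ((t ʳ) [ last (t ʳ) ]) ]) ≡ ω
    c19 : ∀ t α → α ∈ Δ → (t ˡ) [ α ] ∈ Δ → t [ (t ˡ) [ α ] ] ∈ Δ →
          δ ((t ˡ) [ α ]) <̄ ω → δ α ≤̄ δ (t [ (t ˡ) [ α ] ])
    c20 : ∀ t α → α ∈ Δ → (t ˡ) [ α ] ∈ Δ → t [ 𝗉 ((t ˡ) [ α ]) ] ∈ Δ →
          just 0 <̄ δ α → δ α <̄ ω → δ ((t ˡ) [ α ]) <̄ ω →
          δ (t [ 𝗉 ((t ˡ) [ α ]) ]) <̄ δ α
    c21 : ∀ t α → α ∈ Δ → (t ˡ) [ α ] ∈ Δ → t [ (t ˡ) [ α ] ] ∈ Δ →
          δ α <̄ ω → δ ((t ˡ) [ α ]) ≡ ω → δ (t [ (t ˡ) [ α ] ]) <̄ δ α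
    c22 : ∀ t → (t ˡ) [ last (t ˡ) ] ∈ Δ → last (t ˡ) ∈ Δ → last t ∈ Δ →
          δ (last (t ˡ)) ≡ ω → δ (last t) ≡ ω
    c23 : ∀ t → (t ˡ) [ last (t ˡ) ] ∈ Δ →
          t [ (t ˡ) [ last (t ˡ) ] ] ∈ Δ →
          δ ((t ˡ) [ last (t ˡ) ]) <̄ ω →
          δ (t [ (t ˡ) [ last (t ˡ) ] ]) ≡ ω

InD : SampleSet → (Sample → ω̄) → Term → ω̄ → ω̄ → Set
InD Δ δ t i j = Σ[ α ∈ Sample ] (t [ α ] ∈ Δ) × (δ α ≡ i) × (δ (t [ α ]) ≡ j)

DEmpty : SampleSet → Term → Set
DEmpty Δ t = ∀ α → ¬ (t [ α ] ∈ Δ)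

DNonEmpty : SampleSet → Term → Set
DNonEmpty Δ t = Σ[ α ∈ Sample ] (t [ α ] ∈ Δ)

Extends : SampleSet → (Sample → ω̄) → Term → (ω̄ → ω̄) → Set
Extends Δ δ t f = ∀ i j → InD Δ δ t i j → f i ≡ j

StronglyExtends : SampleSet → (Sample → ω̄) → Term → (ω̄ → ω̄) → Set
StronglyExtends Δ δ t f =
  Extends Δ δ t f ×
  (DEmpty Δ t ⊎ (DNonEmpty Δ t → δ (last t) ≡ ω → IsLast f ω))

-- The graph of δ on the samples x[α] ∈ Δ is a finite partial map on ω̄
-- that is monotone (condition 1) and sends 0 to 0 (condition 2).  Any such
-- map extends to a time warp: at n < ω take the largest output whose input
-- is ≤ n, joined with a ramp that starts after the largest finite input and
-- climbs to the prescribed value at ω (to ω if ω is not an input).  This warp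
-- is finite below ω as soon as no finite input has output ω.  When
-- δ(last x) = ω, condition 6 puts (ω, ω) in the graph, and condition 5 shows
-- that every input α with δ(x[α]) = ω = δ(x[last x]) has δ(α) ≥ δ(last x) = ω;
-- so the warp takes the value ω only at ω, which is to say its last is ω.
module Submission where

open import Defs
open import Data.Nat
  using (ℕ; suc; _≤_; _≤?_; _≟_; _⊔_; _⊓_; _∸_; _+_; z≤n)
open import Data.Nat.Properties
  using (≤-refl; ≤-trans; ≤-antisym; m≤m⊔n; m≤n⊔m; ⊔-lub; ⊔-identityʳ;
         ⊓-idem; ⊓-zeroʳ; ⊓-monoʳ-≤; m⊓n≤m; 0∸n≡0; m≤n⇒m∸n≡0; m+n∸n≡m; 1+n≰n;
         ∸-monoˡ-≤)
open import Data.Maybe using (Maybe; just; nothing)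
open import Data.Product using (Σ-syntax; ∃; _×_; _,_)
open import Data.Sum using (_⊎_; inj₁; inj₂)
open import Data.List using (List; []; _∷_; map; foldr)
open import Data.List.Relation.Unary.Any using (here; there)
open import Data.List.Membership.Propositional using (_∈_; _∉_)
open import Data.List.Membership.Propositional.Properties using (∈-map⁺; ∈-map⁻)
open import Data.Empty using (⊥-elim)
open import Relation.Binary.PropositionalEquality
  using (_≡_; _≢_; refl; sym; trans; cong; cong₂; subst; subst₂; module ≡-Reasoning)
open import Relation.Nullary using (yes; no; ¬_)
open import Function.Bundles using (Equivalence)

≤̄-refl : ∀ p → p ≤̄ p
≤̄-refl (just m) = fin≤fin ≤-refl
≤̄-refl nothing  = nothing ≤ω

≤̄-reflexive : ∀ {p q} → p ≡ q → p ≤̄ q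
≤̄-reflexive {p} refl = ≤̄-refl p

≤̄-trans : ∀ {p q r} → p ≤̄ q → q ≤̄ r → p ≤̄ r
≤̄-trans (fin≤fin m≤n) (fin≤fin n≤k) = fin≤fin (≤-trans m≤n n≤k)
≤̄-trans {p} _ (_ ≤ω) = p ≤ω

≤̄-antisym : ∀ {p q} → p ≤̄ q → q ≤̄ p → p ≡ q
≤̄-antisym (fin≤fin m≤n) (fin≤fin n≤m) = cong just (≤-antisym m≤n n≤m)
≤̄-antisym (_ ≤ω) (_ ≤ω) = refl

0≤̄ : ∀ p → just 0 ≤̄ p
0≤̄ (just m) = fin≤fin z≤n
0≤̄ nothing  = just 0 ≤ω

≤̄0⇒≡0 : ∀ {p} → p ≤̄ just 0 → p ≡ just 0
≤̄0⇒≡0 (fin≤fin z≤n) = refl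

ω≰̄fin : ∀ {n} → ¬ (ω ≤̄ just n)
ω≰̄fin ()

infixl 6 _⊔̄_

_⊔̄_ : ω̄ → ω̄ → ω̄
just m  ⊔̄ just n  = just (m ⊔ n)
just _  ⊔̄ nothing = nothing
nothing ⊔̄ _       = nothing

p≤̄p⊔̄q : ∀ p q → p ≤̄ p ⊔̄ q
p≤̄p⊔̄q (just m) (just n) = fin≤fin (m≤m⊔n m n)
p≤̄p⊔̄q (just m) nothing  = just m ≤ω
p≤̄p⊔̄q nothing  q        = nothing ≤ω

q≤̄p⊔̄q : ∀ p q → q ≤̄ p ⊔̄ q
q≤̄p⊔̄q (just m) (just n) = fin≤fin (m≤n⊔m m n)
q≤̄p⊔̄q (just m) nothing  = nothing ≤ω
q≤̄p⊔̄q nothing  q        = q ≤ω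

⊔̄-lub : ∀ {p q r} → p ≤̄ r → q ≤̄ r → p ⊔̄ q ≤̄ r
⊔̄-lub {p} {q} (_ ≤ω) _ = (p ⊔̄ q) ≤ω
⊔̄-lub (fin≤fin m≤k) (fin≤fin n≤k) = fin≤fin (⊔-lub m≤k n≤k)

⊔̄-mono : ∀ {p p′ q q′} → p ≤̄ p′ → q ≤̄ q′ → p ⊔̄ q ≤̄ p′ ⊔̄ q′
⊔̄-mono {p′ = p′} {q′ = q′} p≤p′ q≤q′ =
  ⊔̄-lub (≤̄-trans p≤p′ (p≤̄p⊔̄q p′ q′)) (≤̄-trans q≤q′ (q≤̄p⊔̄q p′ q′))

⊔̄-identityʳ : ∀ p → p ⊔̄ just 0 ≡ p
⊔̄-identityʳ (just m) = cong just (⊔-identityʳ m)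
⊔̄-identityʳ nothing  = refl

⊔̄≡ω : ∀ p q → p ⊔̄ q ≡ ω → p ≡ ω ⊎ q ≡ ω
⊔̄≡ω (just _) nothing  _ = inj₂ refl
⊔̄≡ω nothing  _        _ = inj₁ refl
⊔̄≡ω (just _) (just _) ()

⨆ : List ω̄ → ω̄
⨆ = foldr _⊔̄_ (just 0)

⨆-upper : ∀ {ps p} → p ∈ ps → p ≤̄ ⨆ ps
⨆-upper {p ∷ ps} (here refl) = p≤̄p⊔̄q p (⨆ ps)
⨆-upper {q ∷ ps} (there p∈ps) = ≤̄-trans (⨆-upper p∈ps) (q≤̄p⊔̄q q (⨆ ps))

⨆-least : ∀ {ps v} → (∀ {p} → p ∈ ps → p ≤̄ v) → ⨆ ps ≤̄ v
⨆-least {[]}     {v} _     = 0≤̄ v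
⨆-least {p ∷ ps}     upper = ⊔̄-lub (upper (here refl)) (⨆-least (λ p∈ps → upper (there p∈ps)))

⨆≡ω⇒ω∈ : ∀ ps → ⨆ ps ≡ ω → ω ∈ ps
⨆≡ω⇒ω∈ (p ∷ ps) e with ⊔̄≡ω p (⨆ ps) e
... | inj₁ refl = here refl
... | inj₂ e′   = there (⨆≡ω⇒ω∈ ps e′)

_⊓̄_ : ω̄ → ℕ → ℕ
just c  ⊓̄ k = c ⊓ k
nothing ⊓̄ k = k

⊓̄-monoʳ : ∀ c {k l} → k ≤ l → c ⊓̄ k ≤ c ⊓̄ l
⊓̄-monoʳ (just c) k≤l = ⊓-monoʳ-≤ c k≤l
⊓̄-monoʳ nothing  k≤l = k≤l

⊓̄-zeroʳ : ∀ c → c ⊓̄ 0 ≡ 0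
⊓̄-zeroʳ (just c) = ⊓-zeroʳ c
⊓̄-zeroʳ nothing  = refl

c⊓̄k≤̄c : ∀ c k → just (c ⊓̄ k) ≤̄ c
c⊓̄k≤̄c (just c) k = fin≤fin (m⊓n≤m c k)
c⊓̄k≤̄c nothing  k = just k ≤ω

⊓̄-least : ∀ c v → (∀ k → just (c ⊓̄ k) ≤̄ v) → c ≤̄ v
⊓̄-least (just c) v below = subst (_≤̄ v) (cong just (⊓-idem c)) (below c)
⊓̄-least nothing  nothing _ = nothing ≤ω
⊓̄-least nothing  (just m) below with below (suc m)
... | fin≤fin 1+m≤m = ⊥-elim (1+n≰n 1+m≤m)

isLast-ω : ∀ {f : ω̄ → ω̄} → f ω ≡ ω → (∀ n → f (just n) ≢ ω) → IsLast f ω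
isLast-ω {f} fω≡ω finite = reachesω , (λ v _ → v ≤ω)
  where
  reachesω : ∀ p → f p ≡ f ω → ω ≤̄ p
  reachesω (just n) e = ⊥-elim (finite n (trans e fω≡ω))
  reachesω nothing  _ = nothing ≤ω

PartialMap : Set
PartialMap = List (ω̄ × ω̄)

Monotone : PartialMap → Set
Monotone P = ∀ {i j i′ j′} → (i , j) ∈ P → (i′ , j′) ∈ P → i ≤̄ i′ → j ≤̄ j′

PreservesZero : PartialMap → Set
PreservesZero P = ∀ {j} → (just 0 , j) ∈ P → j ≡ just 0

NoFiniteToω : PartialMap → Set
NoFiniteToω P = ∀ {i} → (just i , ω) ∉ P

ExtendsMap : (ω̄ → ω̄) → PartialMap → Set
ExtendsMap f P = ∀ {i j} → (i , j) ∈ P → f i ≡ j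

valueAtω : PartialMap → ω̄
valueAtω []                  = ω
valueAtω ((nothing , j) ∷ _) = j
valueAtω ((just _ , _) ∷ P)  = valueAtω P

valueAtω-∈ : ∀ {P j} → (ω , j) ∈ P → (ω , valueAtω P) ∈ P
valueAtω-∈ {(nothing , _) ∷ _} _           = here refl
valueAtω-∈ {(just _ , _) ∷ _}  (there ω∈P) = there (valueAtω-∈ ω∈P)

valueAtω-∈⊎≡ω : ∀ P → (ω , valueAtω P) ∈ P ⊎ valueAtω P ≡ ω
valueAtω-∈⊎≡ω []                  = inj₂ refl
valueAtω-∈⊎≡ω ((nothing , _) ∷ _) = inj₁ (here refl)
valueAtω-∈⊎≡ω ((just _ , _) ∷ P) with valueAtω-∈⊎≡ω P
... | inj₁ ω∈P = inj₁ (there ω∈P)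
... | inj₂ e   = inj₂ e

inputBound : PartialMap → ℕ
inputBound []                  = 0
inputBound ((just i , _) ∷ P)  = i ⊔ inputBound P
inputBound ((nothing , _) ∷ P) = inputBound P

≤inputBound : ∀ {P i j} → (just i , j) ∈ P → i ≤ inputBound P
≤inputBound {(just i , _) ∷ P} (here refl) = m≤m⊔n i (inputBound P)
≤inputBound {(just k , _) ∷ P} (there i∈P) = ≤-trans (≤inputBound i∈P) (m≤n⊔m k (inputBound P))
≤inputBound {(nothing , _) ∷ _} (there i∈P) = ≤inputBound i∈P

outputIfBelow : ℕ → ω̄ × ω̄ → ω̄
outputIfBelow n (just i , j) with i ≤? n
... | yes _ = j
... | no _  = just 0
outputIfBelow n (nothing , _) = just 0

outputIfBelow-≡ : ∀ {n i j} → i ≤̄ just n → outputIfBelow n (i , j) ≡ j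
outputIfBelow-≡ {n} {just i} (fin≤fin i≤n) with i ≤? n
... | yes _  = refl
... | no i≰n = ⊥-elim (i≰n i≤n)

outputIfBelow-≤̄ : ∀ {n i j v} → (i ≤̄ just n → j ≤̄ v) → outputIfBelow n (i , j) ≤̄ v
outputIfBelow-≤̄ {n} {just i} {v = v} j≤v with i ≤? n
... | yes i≤n = j≤v (fin≤fin i≤n)
... | no _    = 0≤̄ v
outputIfBelow-≤̄ {i = nothing} {v = v} _ = 0≤̄ v

outputIfBelow≡ω : ∀ {n} e → outputIfBelow n e ≡ ω → ∃ λ i → e ≡ (just i , ω)
outputIfBelow≡ω {n} (just i , j) e with i ≤? n
outputIfBelow≡ω (just i , j) refl | yes _ = i , refl
outputIfBelow≡ω (just i , j) ()   | no _
outputIfBelow≡ω (nothing , j) ()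

supBelow : PartialMap → ℕ → ω̄
supBelow P n = ⨆ (map (outputIfBelow n) P)

supBelow-upper : ∀ {P n i j} → (i , j) ∈ P → i ≤̄ just n → j ≤̄ supBelow P n
supBelow-upper {n = n} ij∈P i≤n =
  subst (_≤̄ _) (outputIfBelow-≡ i≤n) (⨆-upper (∈-map⁺ (outputIfBelow n) ij∈P))

supBelow-least : ∀ {P n v} → (∀ {i j} → (i , j) ∈ P → i ≤̄ just n → j ≤̄ v) → supBelow P n ≤̄ v
supBelow-least {P} {n} {v} upper = ⨆-least bounded
  where
  bounded : ∀ {p} → p ∈ map (outputIfBelow n) P → p ≤̄ v
  bounded p∈ with ∈-map⁻ (outputIfBelow n) p∈
  ... | _ , ij∈P , refl = outputIfBelow-≤̄ (upper ij∈P)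

supBelow-finite : ∀ {P} → NoFiniteToω P → ∀ n → supBelow P n ≢ ω
supBelow-finite {P} noFiniteToω n e
  with ∈-map⁻ (outputIfBelow n) (⨆≡ω⇒ω∈ (map (outputIfBelow n) P) e)
... | e′ , e′∈P , ω≡ with outputIfBelow≡ω e′ (sym ω≡)
... | i , refl = noFiniteToω e′∈P

warp : PartialMap → ω̄ → ω̄
warp P (just n) = supBelow P n ⊔̄ just (valueAtω P ⊓̄ (n ∸ inputBound P))
warp P nothing  = valueAtω P

warp-finite : ∀ {P} → NoFiniteToω P → ∀ n → warp P (just n) ≢ ω
warp-finite {P} noFiniteToω n e with ⊔̄≡ω (supBelow P n) _ e
... | inj₁ supω = supBelow-finite noFiniteToω n supω

module _ {P : PartialMap} (monotone : Monotone P) where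

  ≤valueAtω : ∀ {i j} → (i , j) ∈ P → j ≤̄ valueAtω P
  ≤valueAtω {i} ij∈P with valueAtω-∈⊎≡ω P
  ... | inj₁ ω∈P = monotone ij∈P ω∈P (i ≤ω)
  ... | inj₂ e   = subst (_ ≤̄_) (sym e) (_ ≤ω)

  valueAtω-≡ : ∀ {j} → (ω , j) ∈ P → valueAtω P ≡ j
  valueAtω-≡ ωj∈P = ≤̄-antisym (monotone (valueAtω-∈ ωj∈P) ωj∈P (ω ≤ω)) (≤valueAtω ωj∈P)

  supBelow-mono : ∀ {m n} → m ≤ n → supBelow P m ≤̄ supBelow P n
  supBelow-mono m≤n = supBelow-least {P} λ ij∈P i≤m →
    supBelow-upper ij∈P (≤̄-trans i≤m (fin≤fin m≤n))

  supBelow-≡ : ∀ {n j} → (just n , j) ∈ P → supBelow P n ≡ j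
  supBelow-≡ {n} nj∈P = ≤̄-antisym
    (supBelow-least {P} λ ij∈P i≤n → monotone ij∈P nj∈P i≤n)
    (supBelow-upper nj∈P (≤̄-refl (just n)))

  supBelow≤valueAtω : ∀ n → supBelow P n ≤̄ valueAtω P
  supBelow≤valueAtω n = supBelow-least {P} λ ij∈P _ → ≤valueAtω ij∈P

  warp-below-ω : ∀ n → warp P (just n) ≤̄ warp P ω
  warp-below-ω n = ⊔̄-lub (supBelow≤valueAtω n) (c⊓̄k≤̄c (valueAtω P) _)

  warp-extends : ExtendsMap (warp P) P
  warp-extends {nothing} ωj∈P = valueAtω-≡ ωj∈P
  warp-extends {just n} {j} nj∈P = begin
    supBelow P n ⊔̄ just (valueAtω P ⊓̄ (n ∸ inputBound P))
      ≡⟨ cong₂ (λ s k → s ⊔̄ just (valueAtω P ⊓̄ k))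
               (supBelow-≡ nj∈P) (m≤n⇒m∸n≡0 (≤inputBound nj∈P)) ⟩
    j ⊔̄ just (valueAtω P ⊓̄ 0)
      ≡⟨ cong (λ k → j ⊔̄ just k) (⊓̄-zeroʳ (valueAtω P)) ⟩
    j ⊔̄ just 0
      ≡⟨ ⊔̄-identityʳ j ⟩
    j ∎
    where open ≡-Reasoning

  warp-isTimeWarp : PreservesZero P → IsTimeWarp (warp P)
  warp-isTimeWarp preservesZero = record
    { monotone  = warp-mono
    ; zero↦zero = cong₂ _⊔̄_ supBelow-zero rampZero
    ; ω↦sup     = warp-below-ω , warp-least
    }
    where
    warp-mono : ∀ p q → p ≤̄ q → warp P p ≤̄ warp P q
    warp-mono (just m) (just n) (fin≤fin m≤n) =
      ⊔̄-mono (supBelow-mono m≤n) (fin≤fin (⊓̄-monoʳ (valueAtω P) (∸-monoˡ-≤ (inputBound P) m≤n)))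
    warp-mono (just n) nothing _ = warp-below-ω n
    warp-mono nothing  nothing _ = ≤̄-refl (valueAtω P)

    supBelow-zero : supBelow P 0 ≡ just 0
    supBelow-zero = ≤̄0⇒≡0 (supBelow-least {P} λ ij∈P i≤0 →
      ≤̄-reflexive (preservesZero (subst (λ i → (i , _) ∈ P) (≤̄0⇒≡0 i≤0) ij∈P)))

    rampZero : just (valueAtω P ⊓̄ (0 ∸ inputBound P)) ≡ just 0
    rampZero = cong just
      (trans (cong (valueAtω P ⊓̄_) (0∸n≡0 (inputBound P))) (⊓̄-zeroʳ (valueAtω P)))

    warp-least : ∀ v → (∀ n → warp P (just n) ≤̄ v) → warp P ω ≤̄ v
    warp-least v below = ⊓̄-least (valueAtω P) v λ k →
      subst (λ m → just (valueAtω P ⊓̄ m) ≤̄ v) (m+n∸n≡m k (inputBound P))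
        (≤̄-trans (q≤̄p⊔̄q (supBelow P (k + inputBound P)) _) (below (k + inputBound P)))

argumentOf : (x : TermVar) (s : Sample) → Maybe (∃ λ α → s ≡ var x [ α ])
argumentOf x (var y [ α ]) with y ≟ x
... | yes refl = just (α , refl)
... | no _     = nothing
argumentOf x _ = nothing

argumentOf-var : ∀ x α → argumentOf x (var x [ α ]) ≡ just (α , refl)
argumentOf-var x α with x ≟ x
... | yes refl = refl
... | no x≢x   = ⊥-elim (x≢x refl)

argumentsOf : TermVar → SampleSet → List Sample
argumentsOf x [] = []
argumentsOf x (s ∷ Δ) with argumentOf x s
... | just (α , _) = α ∷ argumentsOf x Δ
... | nothing      = argumentsOf x Δ

∈-argumentsOf⁺ : ∀ {x α Δ} → var x [ α ] ∈ Δ → α ∈ argumentsOf x Δ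
∈-argumentsOf⁺ {x} {α} (here refl) rewrite argumentOf-var x α = here refl
∈-argumentsOf⁺ {x} {Δ = s ∷ _} (there xα∈Δ) with argumentOf x s
... | just _  = there (∈-argumentsOf⁺ xα∈Δ)
... | nothing = ∈-argumentsOf⁺ xα∈Δ

∈-argumentsOf⁻ : ∀ {x α Δ} → α ∈ argumentsOf x Δ → var x [ α ] ∈ Δ
∈-argumentsOf⁻ {x} {Δ = s ∷ _} α∈ with argumentOf x s | α∈
... | just (_ , refl) | here refl = here refl
... | just _          | there α∈Δ = there (∈-argumentsOf⁻ α∈Δ)
... | nothing         | α∈Δ       = there (∈-argumentsOf⁻ α∈Δ)

graph : (Sample → ω̄) → TermVar → SampleSet → PartialMap
graph δ x Δ = map (λ α → δ α , δ (var x [ α ])) (argumentsOf x Δ)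

module _ {Δ : SampleSet} {δ : Sample → ω̄} {x : TermVar} where

  InD⇒∈graph : ∀ {i j} → InD Δ δ (var x) i j → (i , j) ∈ graph δ x Δ
  InD⇒∈graph (_ , xα∈Δ , refl , refl) = ∈-map⁺ _ (∈-argumentsOf⁺ xα∈Δ)

  ∈graph⇒InD : ∀ {i j} → (i , j) ∈ graph δ x Δ → InD Δ δ (var x) i j
  ∈graph⇒InD ij∈ with ∈-map⁻ _ ij∈
  ... | α , α∈ , refl = α , ∈-argumentsOf⁻ α∈ , refl , refl

module _ {Δ : SampleSet} {δ : Sample → ω̄}
         (saturated : Saturated Δ) (diagram : IsDiagram Δ δ) (x : TermVar) where
  open IsDiagram diagram

  argument∈Δ : ∀ {α} → var x [ α ] ∈ Δ → α ∈ Δ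
  argument∈Δ xα∈Δ = saturated xα∈Δ (arg _ _)

  graph-monotone : Monotone (graph δ x Δ)
  graph-monotone ij∈ ij∈′ with ∈graph⇒InD ij∈ | ∈graph⇒InD ij∈′
  ... | α , xα∈Δ , refl , refl | β , xβ∈Δ , refl , refl =
    c1 (var x) α β (argument∈Δ xα∈Δ) (argument∈Δ xβ∈Δ) xα∈Δ xβ∈Δ

  graph-preservesZero : PreservesZero (graph δ x Δ)
  graph-preservesZero 0j∈ with ∈graph⇒InD 0j∈
  ... | α , xα∈Δ , δα≡0 , refl = c2 (var x) α (argument∈Δ xα∈Δ) xα∈Δ δα≡0

  module _ {α₀ : Sample} (xα₀∈Δ : var x [ α₀ ] ∈ Δ) (lastω : δ (last (var x)) ≡ ω) where

    xlast∈Δ : var x [ last (var x) ] ∈ Δ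
    xlast∈Δ = saturated xα₀∈Δ (to-last _ _)

    δxlast≡ω : δ (var x [ last (var x) ]) ≡ ω
    δxlast≡ω = c6 (var x) (argument∈Δ xlast∈Δ) xlast∈Δ lastω

    ωω∈graph : (ω , ω) ∈ graph δ x Δ
    ωω∈graph = InD⇒∈graph (last (var x) , xlast∈Δ , lastω , δxlast≡ω)

    graph-noFiniteToω : NoFiniteToω (graph δ x Δ)
    graph-noFiniteToω iω∈ with ∈graph⇒InD iω∈
    ... | α , xα∈Δ , δα≡i , δxα≡ω = ω≰̄fin (subst₂ _≤̄_ lastω δα≡i last≤α)
      where
      last≤α : δ (last (var x)) ≤̄ δ α
      last≤α = Equivalence.from
        (c5 (var x) α (argument∈Δ xα∈Δ) xα∈Δ (argument∈Δ xlast∈Δ) xlast∈Δ)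
        (trans δxα≡ω (sym δxlast≡ω))

lemma3p16 : (Δ : SampleSet) → Saturated Δ →
    (δ : Sample → ω̄) → IsDiagram Δ δ → (x : TermVar) →
    Σ[ f ∈ (ω̄ → ω̄) ] (IsTimeWarp f × StronglyExtends Δ δ (var x) f)
lemma3p16 Δ saturated δ diagram x =
  warp P , warp-isTimeWarp monotone (graph-preservesZero saturated diagram x) ,
  (λ _ _ ij∈D → warp-extends monotone (InD⇒∈graph ij∈D)) ,
  inj₂ λ (_ , xα₀∈Δ) lastω → isLast-ω
    (warp-extends monotone (ωω∈graph saturated diagram x xα₀∈Δ lastω))
    (warp-finite (graph-noFiniteToω saturated diagram x xα₀∈Δ lastω))
  where
  P : PartialMap
  P = graph δ x Δ

  monotone : Monotone P
  monotone = graph-monotone saturated diagram x
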